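{- Let $s\ge 1$ and $t\ge 2$ be integers. For a linear extension $\pi$ of $SAW_{s,t}$, let $p_1<\dots<p_s$ be the positions in $\pi$ of the root entries $1, t+1, 2t+1, \dots, (s-1)t+1$, and let $\Phi(\pi)$ be the word of length $st$ in the letters $N,E$ having $E$ exactly in the positions $st+1-p_1,\dots,st+1-p_s$ and $N$ in all other positions. Then $\Phi$ is a bijection from the set of linear extensions of $SAW_{s,t}$ onto the set of $t$-Fuss-Catalan paths of semilength $s$.
   Context: Write each $x \in [st]$ uniquely as $x=(j-1)t+r$ with $1\le j\le s$, $1\le r\le t$. The poset $EN_{s,t}$ is $[st]$ with $(j-1)t+r \preceq (j'-1)t+r'$ iff $j'\le j$ and $r\le r'$. The sawblade poset $SAW_{s,t}$ is the poset on $[st]$ whose order is generated by the relations of $EN_{s,t}$ together with $(j+1)t \preceq (j-1)t+2$ for all $1\le j\le s-1$. A linear extension of a poset $([n],\preceq)$ is a permutation $\pi$ of $[n]$ in one-line notation such that whenever $a\preceq b$, $a\ne b$, $a$ appears before $b$. For $s\ge 0$ and $t\ge 2$, a $t$-Fuss-Catalan path of semilength $s$ is a word consisting of $s$ letters $E$ and $(t-1)s$ letters $N$ such that every initial segment contains at least $t-1$ times as many $N$'s as $E$'s. -}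

module Defs where

open import Data.Nat using (ℕ; zero; suc; _+_; _*_; _∸_; _≤_; _<_)
import Data.Nat as ℕ
open import Data.List using (List; []; _∷_; _++_; map; upTo; reverse; take; length; filter)
open import Data.List.Membership.Propositional using (_∈_)
open import Data.List.Membership.DecPropositional ℕ._≟_ using (_∈?_)
open import Data.List.Relation.Binary.Permutation.Propositional using (_↭_)
open import Data.Product using (Σ; ∃; _×_; _,_)
open import Data.Sum using (_⊎_)
open import Relation.Nullary using (¬_; does)
open import Relation.Binary.PropositionalEquality using (_≡_)
open import Relation.Binary.Construct.Closure.ReflexiveTransitive using (Star)
open import Data.Bool using (if_then_else_)

code : ℕ → ℕ → ℕ → ℕ
code t j r = (j ∸ 1) * t + r

ENrel : ℕ → ℕ → ℕ → ℕ → Set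
ENrel s t a b =
  Σ ℕ λ j → Σ ℕ λ r → Σ ℕ λ j' → Σ ℕ λ r' →
    (1 ≤ j) × (j ≤ s) × (1 ≤ r) × (r ≤ t) ×
    (1 ≤ j') × (j' ≤ s) × (1 ≤ r') × (r' ≤ t) ×
    (a ≡ code t j r) × (b ≡ code t j' r') × (j' ≤ j) × (r ≤ r')

SAWextra : ℕ → ℕ → ℕ → ℕ → Set
SAWextra s t a b =
  Σ ℕ λ j → (1 ≤ j) × (j ≤ s ∸ 1) × (a ≡ (j + 1) * t) × (b ≡ (j ∸ 1) * t + 2)

_≼SAW[_,_]_ : ℕ → ℕ → ℕ → ℕ → Set
a ≼SAW[ s , t ] b = Star (λ x y → ENrel s t x y ⊎ SAWextra s t x y) a b

range1 : ℕ → List ℕ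
range1 n = map suc (upTo n)

Before : List ℕ → ℕ → ℕ → Set
Before π a b = Σ (List ℕ) λ xs → Σ (List ℕ) λ ys → (π ≡ xs ++ (a ∷ ys)) × (b ∈ ys)

LinExtSAW : ℕ → ℕ → List ℕ → Set
LinExtSAW s t π =
  (π ↭ range1 (s * t)) ×
  (∀ a b → a ≼SAW[ s , t ] b → ¬ (a ≡ b) → Before π a b)

data Letter : Set where
  N E : Letter

roots : ℕ → ℕ → List ℕ
roots s t = map (λ i → i * t + 1) (upTo s)

-- Φ(π): position q (1-indexed) carries E iff position st+1-q of π holds a
-- root entry, i.e. the reverse of the word marking the root entries of π.
Φ : ℕ → ℕ → List ℕ → List Letter
Φ s t π = reverse (map (λ x → if does (x ∈? roots s t) then E else N) π)

countE : List Letter → ℕ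
countE [] = 0
countE (E ∷ w) = suc (countE w)
countE (N ∷ w) = countE w

countN : List Letter → ℕ
countN [] = 0
countN (N ∷ w) = suc (countN w)
countN (E ∷ w) = countN w

FussCatalan : ℕ → ℕ → List Letter → Set
FussCatalan s t w =
  (countE w ≡ s) × (countN w ≡ (t ∸ 1) * s) ×
  (∀ k → (t ∸ 1) * countE (take k w) ≤ countN (take k w))

module Submission where

open import Level using (Level)
open import Data.Nat using (ℕ; zero; suc; pred; _+_; _*_; _≤_; _<_; z≤n; s≤s; _%_)
import Data.Nat as ℕ
open import Data.Nat.Properties
  using ( suc-injective; +-assoc; +-comm; +-suc; +-identityʳ; *-suc; *-zeroʳ; *-comm
        ; *-distribˡ-+; *-distribʳ-+; +-cancelʳ-≤; +-monoʳ-≤; ≤-pred; ≤-refl; ≤-trans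
        ; n≤1+n; n<1+n; <⇒≤; 1+n≢0; m<n⇒m<1+n; m<1+n⇒m<n∨m≡n; m≤n⇒m<n∨m≡n; <⇒≤pred; module ≤-Reasoning )
open import Data.Nat.DivMod using ([m+kn]%n≡m%n; m<n⇒m%n≡m; m*n%n≡0)
open import Data.Bool using (if_then_else_)
open import Data.Maybe using (just; nothing)
open import Data.Maybe.Relation.Binary.Connected using (Connected; just; just-nothing)
open import Data.List
  using (List; []; _∷_; _++_; map; length; reverse; take; drop; concat; last; head; upTo; applyUpTo; applyDownFrom)
open import Data.List.Properties
  using ( ∷-injectiveʳ; ++-assoc; length-++; length-applyUpTo; length-applyDownFrom; map-upTo; map-cong
        ; reverse-++; reverse-involutive; reverse-injective; unfold-reverse; take++drop≡id )
open import Data.List.Membership.Propositional using (_∈_; _∉_)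
open import Data.List.Membership.Propositional.Properties
  using (∈-++⁺ˡ; ∈-++⁺ʳ; ∈-++⁻; ∈-map⁺; ∈-map⁻; ∈-upTo⁺; ∈-applyUpTo⁺; ∈-applyDownFrom⁺; ∈-concat⁺′)
open import Data.List.Membership.DecPropositional ℕ._≟_ using (_∈?_)
open import Data.List.Relation.Unary.Any using (here; there)
open import Data.List.Relation.Unary.All using (All; []; _∷_)
import Data.List.Relation.Unary.All.Properties as All
open import Data.List.Relation.Unary.AllPairs using ([]; _∷_)
open import Data.List.Relation.Unary.Unique.Propositional using (Unique)
import Data.List.Relation.Unary.Unique.Propositional.Properties as Unique
open import Data.List.Relation.Unary.Linked as Linked using (Linked; []; [-]; _∷_)
import Data.List.Relation.Unary.Linked.Properties as Linked
open import Data.List.Relation.Binary.Permutation.Propositional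
  using (_↭_; ↭-refl; ↭-sym; ↭-trans; ↭⇒↭ₛ; module PermutationReasoning)
open import Data.List.Relation.Binary.Permutation.Propositional.Properties
  using (∈-resp-↭; drop-∷; shift; ++-comm; ++⁺ˡ; ++⁺ʳ)
import Data.List.Relation.Binary.Permutation.Setoid.Properties as PermutationSetoid
open import Data.List.Relation.Ternary.Interleaving.Propositional
  using (Interleaving; []; consˡ; consʳ; toPermutation)
open import Data.Product using (Σ; ∃; _×_; _,_; proj₁; proj₂)
open import Data.Sum using (_⊎_; inj₁; inj₂)
open import Data.Unit using (⊤; tt)
open import Data.Empty using (⊥; ⊥-elim)
open import Function using (_∘_)
open import Relation.Nullary using (¬_; does)
open import Relation.Nullary.Decidable using (dec-true; dec-false)
open import Relation.Binary.PropositionalEquality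
  using (_≡_; _≢_; refl; sym; trans; cong; cong₂; subst; subst₂; setoid; module ≡-Reasoning)
open import Relation.Binary.Construct.Closure.Reflexive as ReflClosure using (ReflClosure; refl; [_])
open import Relation.Binary.Construct.Closure.ReflexiveTransitive using (ε; _◅_)
open import Defs

-- The order of SAW_{s,t} is generated by two chains and the links between them. The roots
-- (s-1)t+1, ..., t+1, 1 form one chain. The non-roots form the other: the entries of each row
-- after its root, row by row from the last row to the first, consecutive rows being joined by
-- the sawblade relations (j+1)t ≼ (j-1)t+2. Besides that, a root only has to precede the first
-- non-root of its own row. So a linear extension is exactly an interleaving of the two chains
-- in which the k-th root comes before the ((k-1)(t-1)+1)-th non-root; writing E for a root
-- and N for a non-root, every prefix of the interleaving's shape has at most t-1 N's per E.
-- The shape is the reverse of Φ(π), and since the total counts are fixed, bounding the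
-- prefixes of a word from one side is the same as bounding its suffixes from the other:
-- this is the Fuss-Catalan condition. An interleaving of two fixed lists is determined by its
-- shape, and every word with the right letter counts is the shape of one.

private
  variable
    a : Level
    A : Set a
    u v w : A
    xs ys l r cs ds : List A

Unique-++⁻ˡ : ∀ xs → Unique (xs ++ ys) → Unique xs
Unique-++⁻ˡ []       _        = []
Unique-++⁻ˡ (_ ∷ xs) (u ∷ un) = All.++⁻ˡ xs u ∷ Unique-++⁻ˡ xs un

Unique-++⁻ʳ : ∀ xs → Unique (xs ++ ys) → Unique ys
Unique-++⁻ʳ []       un       = un
Unique-++⁻ʳ (_ ∷ xs) (_ ∷ un) = Unique-++⁻ʳ xs un

last-applyUpTo : ∀ (f : ℕ → A) n → last (applyUpTo f (suc n)) ≡ just (f n)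
last-applyUpTo f zero    = refl
last-applyUpTo f (suc n) = last-applyUpTo (λ i → f (suc i)) n

applyUpTo-+ : ∀ (f : ℕ → A) m n → applyUpTo f (m + n) ≡ applyUpTo f m ++ applyUpTo (λ i → f (m + i)) n
applyUpTo-+ f zero    n = refl
applyUpTo-+ f (suc m) n = cong (f 0 ∷_) (applyUpTo-+ (λ i → f (suc i)) m n)

applyUpTo-cong : ∀ {f g : ℕ → A} → (∀ i → f i ≡ g i) → ∀ n → applyUpTo f n ≡ applyUpTo g n
applyUpTo-cong {f = f} {g} f≗g n = trans (sym (map-upTo f n)) (trans (map-cong f≗g (upTo n)) (map-upTo g n))

Unique-resp-↭ : xs ↭ ys → Unique xs → Unique ys
Unique-resp-↭ p = PermutationSetoid.Unique-resp-↭ (setoid _) (↭⇒↭ₛ p)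

reverse-invariant : (f : List A → ℕ) → (∀ xs ys → f (xs ++ ys) ≡ f xs + f ys) →
                    ∀ xs → f (reverse xs) ≡ f xs
reverse-invariant f f-++ []       = refl
reverse-invariant f f-++ (x ∷ xs) = begin
  f (reverse (x ∷ xs))        ≡⟨ cong f (unfold-reverse x xs) ⟩
  f (reverse xs ++ x ∷ [])    ≡⟨ f-++ (reverse xs) (x ∷ []) ⟩
  f (reverse xs) + f (x ∷ []) ≡⟨ cong (_+ f (x ∷ [])) (reverse-invariant f f-++ xs) ⟩
  f xs + f (x ∷ [])           ≡⟨ +-comm (f xs) (f (x ∷ [])) ⟩
  f (x ∷ []) + f xs           ≡⟨ f-++ (x ∷ []) xs ⟨
  f (x ∷ xs)                  ∎
  where open ≡-Reasoning

take-length-++ : ∀ (xs ys : List A) → take (length xs) (xs ++ ys) ≡ xs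
take-length-++ []       ys = refl
take-length-++ (x ∷ xs) ys = cong (x ∷_) (take-length-++ xs ys)

reverse-split : ∀ {zs : List A} xs ys → reverse zs ≡ xs ++ ys → zs ≡ reverse ys ++ reverse xs
reverse-split {zs = zs} xs ys eq = begin
  zs                        ≡⟨ reverse-involutive zs ⟨
  reverse (reverse zs)      ≡⟨ cong reverse eq ⟩
  reverse (xs ++ ys)        ≡⟨ reverse-++ xs ys ⟩
  reverse ys ++ reverse xs  ∎
  where open ≡-Reasoning

data Precedes {A : Set a} : List A → A → A → Set a where
  here  : v ∈ xs → Precedes (u ∷ xs) u v
  there : Precedes xs u v → Precedes (w ∷ xs) u v

Before⇒Precedes : ∀ (π : List ℕ) {u v} → Before π u v → Precedes π u v
Before⇒Precedes _ ([] , ys , refl , v∈) = here v∈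
Before⇒Precedes _ (x ∷ xs , ys , refl , v∈) = there (Before⇒Precedes _ (xs , ys , refl , v∈))

Precedes⇒Before : ∀ {π : List ℕ} {u v} → Precedes π u v → Before π u v
Precedes⇒Before (here {xs = ys} v∈) = [] , ys , refl , v∈
Precedes⇒Before (there {w = w} p) with xs , ys , refl , v∈ ← Precedes⇒Before p = w ∷ xs , ys , refl , v∈

Precedes-∈ʳ : Precedes xs u v → v ∈ xs
Precedes-∈ʳ (here v∈) = there v∈
Precedes-∈ʳ (there p) = there (Precedes-∈ʳ p)

Precedes-trans : Unique xs → Precedes xs u v → Precedes xs v w → Precedes xs u w
Precedes-trans (u∉ ∷ _) (here u∈) (here _) = ⊥-elim (All.All¬⇒¬Any u∉ u∈)
Precedes-trans _ (here _) (there q) = here (Precedes-∈ʳ q)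
Precedes-trans (v∉ ∷ _) (there p) (here _) = ⊥-elim (All.All¬⇒¬Any v∉ (Precedes-∈ʳ p))
Precedes-trans (_ ∷ un) (there p) (there q) = there (Precedes-trans un p q)

Precedes-++ˡ : ∀ ys → Precedes xs u v → Precedes (xs ++ ys) u v
Precedes-++ˡ ys (here v∈) = here (∈-++⁺ˡ v∈)
Precedes-++ˡ ys (there p) = there (Precedes-++ˡ ys p)

Precedes-++ʳ : ∀ xs → Precedes ys u v → Precedes (xs ++ ys) u v
Precedes-++ʳ []       p = p
Precedes-++ʳ (_ ∷ xs) p = there (Precedes-++ʳ xs p)

Precedes-++ : u ∈ xs → v ∈ ys → Precedes (xs ++ ys) u v
Precedes-++ {xs = _ ∷ xs} (here refl) v∈ = here (∈-++⁺ʳ xs v∈)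
Precedes-++ (there u∈) v∈ = there (Precedes-++ u∈ v∈)

Precedes-applyUpTo : ∀ (f : ℕ → A) {n i k} → i < k → k < n → Precedes (applyUpTo f n) (f i) (f k)
Precedes-applyUpTo f {suc n} {zero}  {suc k} _         (s≤s k<n) = here (∈-applyUpTo⁺ (λ i → f (suc i)) k<n)
Precedes-applyUpTo f {suc n} {suc i} {suc k} (s≤s i<k) (s≤s k<n) = there (Precedes-applyUpTo (λ i → f (suc i)) i<k k<n)

Precedes-applyDownFrom : ∀ (f : ℕ → A) {n i j} → j < i → i < n → Precedes (applyDownFrom f n) (f i) (f j)
Precedes-applyDownFrom f {suc n} j<i i<1+n with m<1+n⇒m<n∨m≡n i<1+n
... | inj₂ refl = here (∈-applyDownFrom⁺ f j<i)
... | inj₁ i<n  = there (Precedes-applyDownFrom f j<i i<n)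

Precedes-head : Unique (u ∷ xs) → ¬ Precedes (u ∷ xs) v u
Precedes-head (u∉ ∷ _) (here u∈) = All.All¬⇒¬Any u∉ u∈
Precedes-head (u∉ ∷ _) (there p) = All.All¬⇒¬Any u∉ (Precedes-∈ʳ p)

Precedes-uncons : Unique (w ∷ xs) → u ∈ xs → Precedes (w ∷ xs) u v → Precedes xs u v
Precedes-uncons (w∉ ∷ _) w∈ (here _)  = ⊥-elim (All.All¬⇒¬Any w∉ w∈)
Precedes-uncons _        _  (there p) = p

Precedes-concat-between : ∀ (g : ℕ → List A) {n i j} → j < i → i < n → u ∈ g i → v ∈ g j →
                          Precedes (concat (applyDownFrom g n)) u v
Precedes-concat-between g {suc n} j<i i<1+n u∈ v∈ with m<1+n⇒m<n∨m≡n i<1+n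
... | inj₂ refl = Precedes-++ u∈ (∈-concat⁺′ v∈ (∈-applyDownFrom⁺ g j<i))
... | inj₁ i<n  = Precedes-++ʳ (g n) (Precedes-concat-between g j<i i<n u∈ v∈)

Precedes-concat-within : ∀ (g : ℕ → List A) {n i} → i < n → Precedes (g i) u v →
                         Precedes (concat (applyDownFrom g n)) u v
Precedes-concat-within g {suc n} i<1+n p with m<1+n⇒m<n∨m≡n i<1+n
... | inj₂ refl = Precedes-++ˡ _ p
... | inj₁ i<n  = Precedes-++ʳ (g n) (Precedes-concat-within g i<n p)

ReflClosure-Precedes-trans : Unique xs → ReflClosure (Precedes xs) u v → ReflClosure (Precedes xs) v w →
                             ReflClosure (Precedes xs) u w
ReflClosure-Precedes-trans _  refl  q     = q
ReflClosure-Precedes-trans _  [ p ] refl  = [ p ]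
ReflClosure-Precedes-trans un [ p ] [ q ] = [ Precedes-trans un p q ]

-- Interleavings and their shapes

shape : Interleaving l r cs → List Letter
shape []         = []
shape (consˡ sp) = E ∷ shape sp
shape (consʳ sp) = N ∷ shape sp

shape-injective : (sp : Interleaving l r cs) (sp′ : Interleaving l r ds) → shape sp ≡ shape sp′ → cs ≡ ds
shape-injective []         []          _  = refl
shape-injective (consˡ sp) (consˡ sp′) eq = cong (_ ∷_) (shape-injective sp sp′ (∷-injectiveʳ eq))
shape-injective (consʳ sp) (consʳ sp′) eq = cong (_ ∷_) (shape-injective sp sp′ (∷-injectiveʳ eq))
shape-injective (consˡ _)  (consʳ _)   ()
shape-injective (consʳ _)  (consˡ _)   ()

countE-shape : (sp : Interleaving l r cs) → countE (shape sp) ≡ length l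
countE-shape []         = refl
countE-shape (consˡ sp) = cong suc (countE-shape sp)
countE-shape (consʳ sp) = countE-shape sp

countN-shape : (sp : Interleaving l r cs) → countN (shape sp) ≡ length r
countN-shape []         = refl
countN-shape (consˡ sp) = countN-shape sp
countN-shape (consʳ sp) = cong suc (countN-shape sp)

interleaving-of-shape : ∀ w (l r : List A) → countE w ≡ length l → countN w ≡ length r →
                        ∃ λ cs → Σ (Interleaving l r cs) λ sp → shape sp ≡ w
interleaving-of-shape [] [] [] _ _ = [] , [] , refl
interleaving-of-shape (E ∷ w) (x ∷ l) r #E #N
  with cs , sp , refl ← interleaving-of-shape w l r (suc-injective #E) #N = x ∷ cs , consˡ sp , refl
interleaving-of-shape (N ∷ w) l (y ∷ r) #E #N
  with cs , sp , refl ← interleaving-of-shape w l r #E (suc-injective #N) = y ∷ cs , consʳ sp , refl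
interleaving-of-shape []      (_ ∷ _) _       ()  _
interleaving-of-shape []      []      (_ ∷ _) _   ()
interleaving-of-shape (E ∷ w) []      _       ()  _
interleaving-of-shape (N ∷ w) _       []      _   ()

map-shape : (mark : A → Letter) → All (λ x → mark x ≡ E) l → All (λ y → mark y ≡ N) r →
            (sp : Interleaving l r cs) → map mark cs ≡ shape sp
map-shape mark []       []       []         = refl
map-shape mark (e ∷ es) ns       (consˡ sp) = cong₂ _∷_ e (map-shape mark es ns sp)
map-shape mark es       (n ∷ ns) (consʳ sp) = cong₂ _∷_ n (map-shape mark es ns sp)

∈-interleavingˡ : Interleaving l r cs → u ∈ l → u ∈ cs
∈-interleavingˡ (consˡ sp) (here refl) = here refl
∈-interleavingˡ (consˡ sp) (there u∈)  = there (∈-interleavingˡ sp u∈)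
∈-interleavingˡ (consʳ sp) u∈          = there (∈-interleavingˡ sp u∈)

∈-interleavingʳ : Interleaving l r cs → u ∈ r → u ∈ cs
∈-interleavingʳ (consʳ sp) (here refl) = here refl
∈-interleavingʳ (consʳ sp) (there u∈)  = there (∈-interleavingʳ sp u∈)
∈-interleavingʳ (consˡ sp) u∈          = there (∈-interleavingʳ sp u∈)

Precedes-interleavingˡ : Interleaving l r cs → Precedes l u v → Precedes cs u v
Precedes-interleavingˡ (consˡ sp) (here v∈) = here (∈-interleavingˡ sp v∈)
Precedes-interleavingˡ (consˡ sp) (there p) = there (Precedes-interleavingˡ sp p)
Precedes-interleavingˡ (consʳ sp) p         = there (Precedes-interleavingˡ sp p)

Precedes-interleavingʳ : Interleaving l r cs → Precedes r u v → Precedes cs u v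
Precedes-interleavingʳ (consʳ sp) (here v∈) = here (∈-interleavingʳ sp v∈)
Precedes-interleavingʳ (consʳ sp) (there p) = there (Precedes-interleavingʳ sp p)
Precedes-interleavingʳ (consˡ sp) p         = there (Precedes-interleavingʳ sp p)

Linked-Precedes-uncons : Unique (w ∷ cs) → (∀ {u} → u ∈ xs → u ∈ cs) →
                         Linked (Precedes (w ∷ cs)) xs → Linked (Precedes cs) xs
Linked-Precedes-uncons un ⊆cs []      = []
Linked-Precedes-uncons un ⊆cs [-]     = [-]
Linked-Precedes-uncons un ⊆cs (p ∷ L) =
  Precedes-uncons un (⊆cs (here refl)) p ∷ Linked-Precedes-uncons un (⊆cs ∘ there) L

Linked-Precedes-first : Unique (w ∷ cs) → Linked (Precedes (w ∷ cs)) (u ∷ xs) → w ∉ xs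
Linked-Precedes-first un (p ∷ _) (here refl) = Precedes-head un p
Linked-Precedes-first un (_ ∷ L) (there w∈)  = Linked-Precedes-first un L w∈

-- The head of cs has no predecessor in cs, so it must be the head of l or of r.
chains⇒interleaving : Unique cs → cs ↭ l ++ r →
                      Linked (Precedes cs) l → Linked (Precedes cs) r → Interleaving l r cs
chains⇒interleaving {cs = []} {l = []} {r = []} _ _ _ _ = []
chains⇒interleaving {cs = []} {l = _ ∷ _} _ p _ _ with () ← ∈-resp-↭ (↭-sym p) (here refl)
chains⇒interleaving {cs = []} {l = []} {r = _ ∷ _} _ p _ _ with () ← ∈-resp-↭ (↭-sym p) (here refl)
chains⇒interleaving {cs = z ∷ cs} {l = l} un p Ll Lr with ∈-++⁻ l (∈-resp-↭ p (here refl))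
... | inj₁ (there z∈) = ⊥-elim (Linked-Precedes-first un Ll z∈)
... | inj₂ (there z∈) = ⊥-elim (Linked-Precedes-first un Lr z∈)
chains⇒interleaving {cs = z ∷ cs} {l = .z ∷ l} {r} un@(_ ∷ un′) p Ll Lr | inj₁ (here refl) =
  consˡ (chains⇒interleaving un′ p′
    (Linked-Precedes-uncons un (∈-resp-↭ (↭-sym p′) ∘ ∈-++⁺ˡ) (Linked.tail Ll))
    (Linked-Precedes-uncons un (∈-resp-↭ (↭-sym p′) ∘ ∈-++⁺ʳ l) Lr))
  where
    p′ : cs ↭ l ++ r
    p′ = drop-∷ p
chains⇒interleaving {cs = z ∷ cs} {l = l} {r = .z ∷ r} un@(_ ∷ un′) p Ll Lr | inj₂ (here refl) =
  consʳ (chains⇒interleaving un′ p′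
    (Linked-Precedes-uncons un (∈-resp-↭ (↭-sym p′) ∘ ∈-++⁺ˡ) Ll)
    (Linked-Precedes-uncons un (∈-resp-↭ (↭-sym p′) ∘ ∈-++⁺ʳ l) (Linked.tail Lr)))
  where
    p′ : cs ↭ l ++ r
    p′ = drop-∷ (↭-trans p (shift z l r))

-- Ballot words

Ballot : ℕ → ℕ → List Letter → Set
Ballot d c       []      = ⊤
Ballot d c       (E ∷ w) = Ballot d (c + d) w
Ballot d zero    (N ∷ w) = ⊥
Ballot d (suc c) (N ∷ w) = Ballot d c w

countE-++ : ∀ x y → countE (x ++ y) ≡ countE x + countE y
countE-++ []      y = refl
countE-++ (E ∷ x) y = cong suc (countE-++ x y)
countE-++ (N ∷ x) y = countE-++ x y

countN-++ : ∀ x y → countN (x ++ y) ≡ countN x + countN y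
countN-++ []      y = refl
countN-++ (E ∷ x) y = countN-++ x y
countN-++ (N ∷ x) y = cong suc (countN-++ x y)

countE-reverse : ∀ w → countE (reverse w) ≡ countE w
countE-reverse = reverse-invariant countE countE-++

countN-reverse : ∀ w → countN (reverse w) ≡ countN w
countN-reverse = reverse-invariant countN countN-++

ballot-credit : ∀ c d e → c + d * suc e ≡ (c + d) + d * e
ballot-credit c d e = trans (cong (c +_) (*-suc d e)) (sym (+-assoc c d (d * e)))

Ballot⇒prefix-bound : ∀ {d c} x {y} → Ballot d c (x ++ y) → countN x ≤ c + d * countE x
Ballot⇒prefix-bound             []      _ = z≤n
Ballot⇒prefix-bound {d} {c}     (E ∷ x) b =
  subst (countN x ≤_) (sym (ballot-credit c d (countE x))) (Ballot⇒prefix-bound x b)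
Ballot⇒prefix-bound {c = suc c} (N ∷ x) b = s≤s (Ballot⇒prefix-bound x b)

prefix-bound⇒Ballot : ∀ {d c} w → (∀ x y → w ≡ x ++ y → countN x ≤ c + d * countE x) → Ballot d c w
prefix-bound⇒Ballot             []      _     = tt
prefix-bound⇒Ballot {d} {c}     (E ∷ w) bound = prefix-bound⇒Ballot w λ x y w≡ →
  subst (countN x ≤_) (ballot-credit c d (countE x)) (bound (E ∷ x) y (cong (E ∷_) w≡))
prefix-bound⇒Ballot {d} {zero}  (N ∷ w) bound with () ← subst (1 ≤_) (*-zeroʳ d) (bound (N ∷ []) w refl)
prefix-bound⇒Ballot {c = suc c} (N ∷ w) bound = prefix-bound⇒Ballot w λ x y w≡ →
  ≤-pred (bound (N ∷ x) y (cong (N ∷_) w≡))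

≤-complement : ∀ {m n o p} → m + n ≡ o + p → n ≤ p → o ≤ m
≤-complement {m} {n} {o} {p} eq n≤p = +-cancelʳ-≤ p o m (begin
  o + p ≡⟨ eq ⟨
  m + n ≤⟨ +-monoʳ-≤ m n≤p ⟩
  m + p ∎)
  where open ≤-Reasoning

module _ (d : ℕ) {w} (pre suf : List Letter) (w≡ : w ≡ pre ++ suf) (balanced : countN w ≡ d * countE w) where

  private
    split-counts : countN pre + countN suf ≡ d * countE pre + d * countE suf
    split-counts = begin
      countN pre + countN suf             ≡⟨ countN-++ pre suf ⟨
      countN (pre ++ suf)                 ≡⟨ cong countN w≡ ⟨
      countN w                            ≡⟨ balanced ⟩
      d * countE w                        ≡⟨ cong (λ v → d * countE v) w≡ ⟩
      d * countE (pre ++ suf)             ≡⟨ cong (d *_) (countE-++ pre suf) ⟩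
      d * (countE pre + countE suf)       ≡⟨ *-distribˡ-+ d (countE pre) (countE suf) ⟩
      d * countE pre + d * countE suf     ∎
      where open ≡-Reasoning

  suffix-bound⇒prefix-bound : countN suf ≤ d * countE suf → d * countE pre ≤ countN pre
  suffix-bound⇒prefix-bound = ≤-complement split-counts

  prefix-bound⇒suffix-bound : d * countE pre ≤ countN pre → countN suf ≤ d * countE suf
  prefix-bound⇒suffix-bound = ≤-complement (begin
    d * countE suf + d * countE pre ≡⟨ +-comm (d * countE suf) _ ⟩
    d * countE pre + d * countE suf ≡⟨ split-counts ⟨
    countN pre + countN suf         ≡⟨ +-comm (countN pre) _ ⟩
    countN suf + countN pre         ∎)
    where open ≡-Reasoning

Ballot-reverse⇒suffix-bound : ∀ {d w} pre suf → Ballot d 0 (reverse w) → w ≡ pre ++ suf →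
                              countN suf ≤ d * countE suf
Ballot-reverse⇒suffix-bound {d} pre suf b refl =
  subst₂ _≤_ (countN-reverse suf) (cong (d *_) (countE-reverse suf))
    (Ballot⇒prefix-bound (reverse suf) (subst (Ballot d 0) (reverse-++ pre suf) b))

suffix-bound⇒Ballot-reverse : ∀ {d} w → (∀ pre suf → w ≡ pre ++ suf → countN suf ≤ d * countE suf) →
                              Ballot d 0 (reverse w)
suffix-bound⇒Ballot-reverse {d} w bound = prefix-bound⇒Ballot (reverse w) λ x y eq →
  subst₂ _≤_ (countN-reverse x) (cong (d *_) (countE-reverse x)) (bound (reverse y) (reverse x) (reverse-split x y eq))

-- Both directions pass through complements: the prefixes of reverse w are the reversed
-- suffixes of w, and on a balanced word the bound on a suffix is equivalent to the
-- opposite bound on the complementary prefix.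
ballot⇒fussCatalan : ∀ {d} w → countN w ≡ d * countE w → Ballot d 0 (reverse w) →
                     ∀ k → d * countE (take k w) ≤ countN (take k w)
ballot⇒fussCatalan {d} w balanced b k =
  suffix-bound⇒prefix-bound d (take k w) (drop k w) w≡ balanced (Ballot-reverse⇒suffix-bound (take k w) (drop k w) b w≡)
  where
    w≡ : w ≡ take k w ++ drop k w
    w≡ = sym (take++drop≡id k w)

fussCatalan⇒ballot : ∀ {d} w → countN w ≡ d * countE w →
                     (∀ k → d * countE (take k w) ≤ countN (take k w)) → Ballot d 0 (reverse w)
fussCatalan⇒ballot {d} w balanced fc = suffix-bound⇒Ballot-reverse w λ pre suf w≡ →
  prefix-bound⇒suffix-bound d pre suf w≡ balanced
    (subst (λ v → d * countE v ≤ countN v) (trans (cong (take (length pre)) w≡) (take-length-++ pre suf))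
      (fc (length pre)))

module HeadsAndBlocks {a} {A : Set a} (hd first : ℕ → A) (rest : ℕ → List A)
                      {d : ℕ} (length-rest : ∀ k → length (rest k) ≡ d) where

  block : ℕ → List A
  block k = first k ∷ rest k

  blocks : ℕ → List A
  blocks k = concat (applyDownFrom block k)

  length-blocks : ∀ k → length (blocks k) ≡ k * suc d
  length-blocks zero    = refl
  length-blocks (suc k) = trans (length-++ (block k)) (cong₂ _+_ (cong suc (length-rest k)) (length-blocks k))

  length-++-block : ∀ P {c} k → length P ≡ c → length (P ++ block k) ≡ c + suc d
  length-++-block P k refl = trans (length-++ P) (cong (length P +_) (cong suc (length-rest k)))

  -- Generalised for the induction: the c credits are a prefix P of the second list lying before all blocks.
  ballot⇒heads-first : ∀ {l r cs k P c} (sp : Interleaving l r cs) →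
                       l ≡ applyDownFrom hd k → r ≡ P ++ blocks k → length P ≡ c →
                       Ballot (suc d) c (shape sp) → ∀ {j} → j < k → Precedes cs (hd j) (first j)
  ballot⇒heads-first {k = suc k} {P} (consˡ sp) refl r≡ |P| b {j} j<1+k with m<1+n⇒m<n∨m≡n j<1+k
  ... | inj₂ refl = here (∈-interleavingʳ sp (subst (first k ∈_) (sym r≡) (∈-++⁺ʳ P (here refl))))
  ... | inj₁ j<k  = there (ballot⇒heads-first sp refl (trans r≡ (sym (++-assoc P (block k) (blocks k))))
                                              (length-++-block P k |P|) b j<k)
  ballot⇒heads-first {P = _ ∷ P} {suc c} (consʳ sp) l≡ refl |P| b j<k =
    there (ballot⇒heads-first sp l≡ refl (suc-injective |P|) b j<k)
  ballot⇒heads-first {k = zero} []         _ _ _ _ ()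
  ballot⇒heads-first {k = suc _} []        () _ _ _ _
  ballot⇒heads-first {k = zero} (consˡ _)  () _ _ _ _
  ballot⇒heads-first {c = zero} (consʳ _)  _ _ _ () _
  ballot⇒heads-first {P = []} {suc c} (consʳ _) _ _ () _ _

  heads-first⇒ballot : ∀ {l r cs k P c} (sp : Interleaving l r cs) → Unique cs →
                       l ≡ applyDownFrom hd k → r ≡ P ++ blocks k → length P ≡ c →
                       (∀ {j} → j < k → Precedes cs (hd j) (first j)) → Ballot (suc d) c (shape sp)
  heads-first⇒ballot [] _ _ _ _ _ = tt
  heads-first⇒ballot {k = suc k} {P} (consˡ sp) (u ∷ un) refl r≡ |P| first =
    heads-first⇒ballot sp un refl (trans r≡ (sym (++-assoc P (block k) (blocks k)))) (length-++-block P k |P|)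
      λ j<k → Precedes-uncons (u ∷ un) (∈-interleavingˡ sp (∈-applyDownFrom⁺ hd j<k)) (first (m<n⇒m<1+n j<k))
  heads-first⇒ballot {k = suc k} {[]} {zero} (consʳ sp) (u ∷ un) refl refl |P| first =
    Precedes-head (u ∷ un) (first (n<1+n k))
  heads-first⇒ballot {P = _ ∷ P} {suc c} (consʳ sp) (u ∷ un) l≡ refl |P| first =
    heads-first⇒ballot sp un l≡ refl (suc-injective |P|)
      λ j<k → Precedes-uncons (u ∷ un) (∈-interleavingˡ sp (subst (_ ∈_) (sym l≡) (∈-applyDownFrom⁺ hd j<k)))
                              (first j<k)
  heads-first⇒ballot {k = zero} (consˡ _) _ () _ _ _
  heads-first⇒ballot {k = zero} {[]} {zero} (consʳ _) _ _ () _ _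
  heads-first⇒ballot {P = _ ∷ _} {zero} (consʳ _) _ _ _ () _
  heads-first⇒ballot {P = []} {suc _} (consʳ _) _ _ _ () _

-- The sawblade poset

SAWstep : ℕ → ℕ → ℕ → ℕ → Set
SAWstep s t a b = ENrel s t a b ⊎ SAWextra s t a b

≤pred⇒< : ∀ {m n} → suc m ≤ pred n → suc m < n
≤pred⇒< {n = suc n} 1+m≤n = s≤s 1+m≤n

-- Rows are indexed from 0: row j is root j = jt+1 followed by its block
-- nonroot j 0, ..., nonroot j u, that is jt+2, ..., jt+t.
module Sawblade (s u : ℕ) where

  t : ℕ
  t = suc (suc u)

  root : ℕ → ℕ
  root j = j * t + 1

  nonroot : ℕ → ℕ → ℕ
  nonroot j i = j * t + (2 + i)

  open HeadsAndBlocks root (λ j → nonroot j 0) (λ j → applyUpTo (λ i → nonroot j (suc i)) u)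
                      (λ j → length-applyUpTo _ u) public

  rootChain blockChain : List ℕ
  rootChain  = applyDownFrom root s
  blockChain = blocks s

  mark : ℕ → Letter
  mark x = if does (x ∈? roots s t) then E else N

  root∈roots : ∀ {j} → j < s → root j ∈ roots s t
  root∈roots j<s = ∈-map⁺ (λ i → i * t + 1) (∈-upTo⁺ j<s)

  nonroot∉roots : ∀ j {i} → i ≤ u → nonroot j i ∉ roots s t
  nonroot∉roots j {i} i≤u x∈ with i′ , _ , eq ← ∈-map⁻ (λ i → i * t + 1) x∈ = 1+n≢0 (begin
      suc i                ≡⟨ m<n⇒m%n≡m (s≤s (s≤s i≤u)) ⟨
      suc i % t            ≡⟨ [m+kn]%n≡m%n (suc i) j t ⟨
      (suc i + j * t) % t  ≡⟨ cong (_% t) (+-comm (suc i) (j * t)) ⟩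
      (j * t + suc i) % t  ≡⟨ cong (_% t) (suc-injective shifted) ⟩
      (i′ * t) % t         ≡⟨ m*n%n≡0 i′ t ⟩
      0                    ∎)
    where
      open ≡-Reasoning
      shifted : suc (j * t + suc i) ≡ suc (i′ * t)
      shifted = trans (sym (+-suc (j * t) (suc i))) (trans eq (+-comm (i′ * t) 1))

  mark-root : ∀ {j} → j < s → mark (root j) ≡ E
  mark-root j<s = cong (if_then E else N) (dec-true (_ ∈? roots s t) (root∈roots j<s))

  mark-nonroot : ∀ j {i} → i ≤ u → mark (nonroot j i) ≡ N
  mark-nonroot j i≤u = cong (if_then E else N) (dec-false (_ ∈? roots s t) (nonroot∉roots j i≤u))

  rootChain-marked : All (λ x → mark x ≡ E) rootChain
  rootChain-marked = All.applyDownFrom⁺₁ root s mark-root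

  blockChain-marked : All (λ x → mark x ≡ N) blockChain
  blockChain-marked = All.concat⁺ (All.applyDownFrom⁺₂ block s λ j →
                        All.applyUpTo⁺₁ (nonroot j) (suc u) λ { (s≤s i≤u) → mark-nonroot j i≤u })

  Φ-shape : ∀ {π} (sp : Interleaving rootChain blockChain π) → Φ s t π ≡ reverse (shape sp)
  Φ-shape sp = cong reverse (map-shape mark rootChain-marked blockChain-marked sp)

  range1-row : ∀ k → range1 (k * t + t) ≡ range1 (k * t) ++ (root k ∷ block k)
  range1-row k = begin
    range1 (k * t + t)
      ≡⟨ map-upTo suc (k * t + t) ⟩
    applyUpTo suc (k * t + t)
      ≡⟨ applyUpTo-+ suc (k * t) t ⟩
    applyUpTo suc (k * t) ++ applyUpTo (λ i → suc (k * t + i)) t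
      ≡⟨ cong₂ _++_ (sym (map-upTo suc (k * t))) (applyUpTo-cong (λ i → sym (+-suc (k * t) i)) t) ⟩
    range1 (k * t) ++ (root k ∷ block k)
      ∎
    where open ≡-Reasoning

  heads++blocks↭range1 : ∀ k → applyDownFrom root k ++ blocks k ↭ range1 (k * t)
  heads++blocks↭range1 zero    = ↭-refl
  heads++blocks↭range1 (suc k) = begin
    root k ∷ H ++ B ++ Bs           ↭⟨ shift (root k) H (B ++ Bs) ⟨
    H ++ (root k ∷ B) ++ Bs         ↭⟨ ++⁺ˡ H (++-comm (root k ∷ B) Bs) ⟩
    H ++ Bs ++ (root k ∷ B)         ≡⟨ ++-assoc H Bs (root k ∷ B) ⟨
    (H ++ Bs) ++ (root k ∷ B)       ↭⟨ ++⁺ʳ (root k ∷ B) (heads++blocks↭range1 k) ⟩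
    range1 (k * t) ++ (root k ∷ B)  ≡⟨ range1-row k ⟨
    range1 (k * t + t)              ≡⟨ cong range1 (+-comm (k * t) t) ⟩
    range1 (suc k * t)              ∎
    where
      open PermutationReasoning
      H B Bs : List ℕ
      H  = applyDownFrom root k
      B  = block k
      Bs = blocks k

  mkENrel : ∀ {j r j′ r′} → j < s → r < t → r′ < t → j′ ≤ j → r ≤ r′ →
            ENrel s t (j * t + suc r) (j′ * t + suc r′)
  mkENrel j<s r<t r′<t j′≤j r≤r′ =
    _ , _ , _ , _ , s≤s z≤n , j<s , s≤s z≤n , r<t , s≤s z≤n , ≤-trans (s≤s j′≤j) j<s , s≤s z≤n , r′<t ,
    refl , refl , s≤s j′≤j , s≤s r≤r′

  row-end : ∀ j → (suc j + 1) * t ≡ nonroot (suc j) u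
  row-end j = trans (*-distribʳ-+ t (suc j) 1) (cong (suc j * t +_) (+-identityʳ t))

  root-step : ∀ {j} → suc j < s → SAWstep s t (root (suc j)) (root j)
  root-step {j} 1+j<s = inj₁ (mkENrel 1+j<s (s≤s z≤n) (s≤s z≤n) (n≤1+n j) ≤-refl)

  root-block-step : ∀ {j} → j < s → SAWstep s t (root j) (nonroot j 0)
  root-block-step j<s = inj₁ (mkENrel j<s (s≤s z≤n) (s≤s (s≤s z≤n)) ≤-refl z≤n)

  block-step : ∀ {j i} → j < s → suc i ≤ u → SAWstep s t (nonroot j i) (nonroot j (suc i))
  block-step {i = i} j<s 1+i≤u =
    inj₁ (mkENrel j<s (s≤s (s≤s (<⇒≤ 1+i≤u))) (s≤s (s≤s 1+i≤u)) ≤-refl (n≤1+n (suc i)))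

  block-junction-step : ∀ {j} → suc j < s → SAWstep s t (nonroot (suc j) u) (nonroot j 0)
  block-junction-step {j} 1+j<s = inj₂ (suc j , s≤s z≤n , <⇒≤pred 1+j<s , sym (row-end j) , refl)

  rootChain-linked : Linked (SAWstep s t) rootChain
  rootChain-linked = Linked.applyDownFrom⁺₁ root s root-step

  block-linked : ∀ {j} → j < s → Linked (SAWstep s t) (block j)
  block-linked {j} j<s = Linked.applyUpTo⁺₁ (nonroot j) (suc u) λ { (s≤s 1+i≤u) → block-step j<s 1+i≤u }

  blocks-linked : ∀ {k} → k ≤ s → Linked (SAWstep s t) (blocks k)
  blocks-linked {zero}  _     = []
  blocks-linked {suc k} 1+k≤s =
    Linked.++⁺ (block-linked 1+k≤s) (junction k 1+k≤s) (blocks-linked (≤-trans (n≤1+n k) 1+k≤s))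
    where
      junction : ∀ k → k < s → Connected (SAWstep s t) (last (block k)) (head (blocks k))
      junction zero    _     = subst (λ m → Connected (SAWstep s t) m nothing)
                                 (sym (last-applyUpTo (nonroot 0) u)) just-nothing
      junction (suc k) 1+k<s = subst (λ m → Connected (SAWstep s t) m (just (nonroot k 0)))
                                 (sym (last-applyUpTo (nonroot (suc k)) u)) (just (block-junction-step 1+k<s))

  Unique-chains : Unique (rootChain ++ blockChain)
  Unique-chains = Unique-resp-↭ (↭-sym (heads++blocks↭range1 s))
                                (Unique.map⁺ suc-injective (Unique.upTo⁺ (s * t)))

  module _ {π} (L : LinExtSAW s t π) where

    private
      π↭ : π ↭ rootChain ++ blockChain
      π↭ = ↭-trans (proj₁ L) (↭-sym (heads++blocks↭range1 s))

      Unique-π : Unique π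
      Unique-π = Unique-resp-↭ (↭-sym π↭) Unique-chains

      step⇒precedes : ∀ {a b} → SAWstep s t a b → a ≢ b → Precedes π a b
      step⇒precedes a⋖b a≢b = Before⇒Precedes π (proj₂ L _ _ (a⋖b ◅ ε) a≢b)

      chain⇒linked : ∀ {C} → Linked (SAWstep s t) C → Unique C → Linked (Precedes π) C
      chain⇒linked LC UC = Linked.zipWith (λ (c , ne) → step⇒precedes c ne) (LC , Linked.AllPairs⇒Linked UC)

    linExt⇒interleaving : Interleaving rootChain blockChain π
    linExt⇒interleaving = chains⇒interleaving Unique-π π↭
      (chain⇒linked rootChain-linked (Unique-++⁻ˡ rootChain Unique-chains))
      (chain⇒linked (blocks-linked ≤-refl) (Unique-++⁻ʳ rootChain Unique-chains))

    linExt⇒ballot : Ballot (suc u) 0 (shape linExt⇒interleaving)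
    linExt⇒ballot = heads-first⇒ballot linExt⇒interleaving Unique-π refl refl refl λ {j} j<s →
      step⇒precedes (root-block-step j<s)
        λ eq → nonroot∉roots j z≤n (subst (_∈ roots s t) eq (root∈roots j<s))

  rootChain-order : ∀ {j j′} → j′ ≤ j → j < s → ReflClosure (Precedes rootChain) (root j) (root j′)
  rootChain-order j′≤j j<s with m≤n⇒m<n∨m≡n j′≤j
  ... | inj₁ j′<j = [ Precedes-applyDownFrom root j′<j j<s ]
  ... | inj₂ refl = refl

  blockChain-between : ∀ {j j′ i i′} → j′ < j → j < s → i ≤ u → i′ ≤ u →
                       Precedes blockChain (nonroot j i) (nonroot j′ i′)
  blockChain-between {j} {j′} j′<j j<s i≤u i′≤u =
    Precedes-concat-between block j′<j j<s (∈-applyUpTo⁺ (nonroot j) (s≤s i≤u))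
                                           (∈-applyUpTo⁺ (nonroot j′) (s≤s i′≤u))

  blockChain-order : ∀ {j j′ i i′} → j′ ≤ j → j < s → i ≤ i′ → i′ ≤ u →
                     ReflClosure (Precedes blockChain) (nonroot j i) (nonroot j′ i′)
  blockChain-order {j} j′≤j j<s i≤i′ i′≤u with m≤n⇒m<n∨m≡n j′≤j | m≤n⇒m<n∨m≡n i≤i′
  ... | inj₁ j′<j | _         = [ blockChain-between j′<j j<s (≤-trans i≤i′ i′≤u) i′≤u ]
  ... | inj₂ refl | inj₁ i<i′ =
    [ Precedes-concat-within block j<s (Precedes-applyUpTo (nonroot j) i<i′ (s≤s i′≤u)) ]
  ... | inj₂ refl | inj₂ refl = refl

  module _ {π} (sp : Interleaving rootChain blockChain π) (ballot : Ballot (suc u) 0 (shape sp)) where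

    private
      π↭ : π ↭ range1 (s * t)
      π↭ = ↭-trans (toPermutation sp) (heads++blocks↭range1 s)

      Unique-π : Unique π
      Unique-π = Unique-resp-↭ (↭-sym (toPermutation sp)) Unique-chains

      _⊑_ : ℕ → ℕ → Set
      _⊑_ = ReflClosure (Precedes π)

      ⊑-trans : ∀ {a b c} → a ⊑ b → b ⊑ c → a ⊑ c
      ⊑-trans = ReflClosure-Precedes-trans Unique-π

      root-first : ∀ {j} → j < s → root j ⊑ nonroot j 0
      root-first j<s = [ ballot⇒heads-first sp refl refl refl ballot j<s ]

      en-order : ∀ {j r j′ r′} → j < s → r < t → r′ < t → j′ ≤ j → r ≤ r′ →
                 (j * t + suc r) ⊑ (j′ * t + suc r′)
      en-order {r = zero}  {r′ = zero}   j<s _ _ j′≤j _ =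
        ReflClosure.map (Precedes-interleavingˡ sp) (rootChain-order j′≤j j<s)
      en-order {r = zero}  {r′ = suc i′} j<s _ (s≤s (s≤s i′≤u)) j′≤j _ =
        ⊑-trans (root-first j<s)
                (ReflClosure.map (Precedes-interleavingʳ sp) (blockChain-order j′≤j j<s z≤n i′≤u))
      en-order {r = suc i} {r′ = suc i′} j<s _ (s≤s (s≤s i′≤u)) j′≤j (s≤s i≤i′) =
        ReflClosure.map (Precedes-interleavingʳ sp) (blockChain-order j′≤j j<s i≤i′ i′≤u)

      step⇒⊑ : ∀ {a b} → SAWstep s t a b → a ⊑ b
      step⇒⊑ (inj₁ (suc _ , suc _ , suc _ , suc _ , _ , j<s , _ , r<t , _ , _ , _ , r′<t ,
                    refl , refl , s≤s j′≤j , s≤s r≤r′)) =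
        en-order j<s r<t r′<t j′≤j r≤r′
      step⇒⊑ (inj₂ (suc j , _ , 1+j≤s∸1 , refl , refl)) = subst (_⊑ nonroot j 0) (sym (row-end j))
        [ Precedes-interleavingʳ sp (blockChain-between (n<1+n j) (≤pred⇒< 1+j≤s∸1) ≤-refl z≤n) ]

      ≼⇒⊑ : ∀ {a b} → a ≼SAW[ s , t ] b → a ⊑ b
      ≼⇒⊑ ε          = refl
      ≼⇒⊑ (a⋖b ◅ b≼c) = ⊑-trans (step⇒⊑ a⋖b) (≼⇒⊑ b≼c)

    interleaving⇒linExt : LinExtSAW s t π
    interleaving⇒linExt = π↭ , λ a b a≼b a≢b → Precedes⇒Before (strict (≼⇒⊑ a≼b) a≢b)
      where
        strict : ∀ {a b} → a ⊑ b → a ≢ b → Precedes π a b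
        strict refl  a≢a = ⊥-elim (a≢a refl)
        strict [ p ] _   = p

  ballot⇒fussCatalan-shape : ∀ {π} (sp : Interleaving rootChain blockChain π) →
                             Ballot (suc u) 0 (shape sp) → FussCatalan s t (reverse (shape sp))
  ballot⇒fussCatalan-shape sp ballot =
    #E , #N , ballot⇒fussCatalan word (trans #N (cong (suc u *_) (sym #E))) ballot′
    where
      word : List Letter
      word = reverse (shape sp)
      #E : countE word ≡ s
      #E = trans (countE-reverse (shape sp)) (trans (countE-shape sp) (length-applyDownFrom root s))
      #N : countN word ≡ suc u * s
      #N = trans (countN-reverse (shape sp)) (trans (countN-shape sp) (trans (length-blocks s) (*-comm s (suc u))))
      ballot′ : Ballot (suc u) 0 (reverse word)
      ballot′ = subst (Ballot (suc u) 0) (sym (reverse-involutive (shape sp))) ballot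

  fussCatalan⇒ballot-shape : ∀ {w} → FussCatalan s t w →
                             ∃ λ π → Σ (Interleaving rootChain blockChain π) λ sp →
                               shape sp ≡ reverse w × Ballot (suc u) 0 (shape sp)
  fussCatalan⇒ballot-shape {w} (#E , #N , prefix)
    with π , sp , shape≡ ← interleaving-of-shape (reverse w) rootChain blockChain
           (trans (countE-reverse w) (trans #E (sym (length-applyDownFrom root s))))
           (trans (countN-reverse w) (trans #N (trans (*-comm (suc u) s) (sym (length-blocks s)))))
    = π , sp , shape≡ ,
      subst (Ballot (suc u) 0) (sym shape≡) (fussCatalan⇒ballot w (trans #N (cong (suc u *_) (sym #E))) prefix)

theorem4p8 : (s t : ℕ) → 1 ≤ s → 2 ≤ t →
    ((π : List ℕ) → LinExtSAW s t π → FussCatalan s t (Φ s t π)) ×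
    ((π π′ : List ℕ) → LinExtSAW s t π → LinExtSAW s t π′ → Φ s t π ≡ Φ s t π′ → π ≡ π′) ×
    ((w : List Letter) → FussCatalan s t w → Σ (List ℕ) λ π → LinExtSAW s t π × (Φ s t π ≡ w))
-- The argument works for s = 0 as well.
theorem4p8 s (suc (suc u)) _ (s≤s (s≤s z≤n)) = into , injective , onto
  where
    open Sawblade s u

    into : ∀ π → LinExtSAW s t π → FussCatalan s t (Φ s t π)
    into π L = subst (FussCatalan s t) (sym (Φ-shape (linExt⇒interleaving L)))
                 (ballot⇒fussCatalan-shape (linExt⇒interleaving L) (linExt⇒ballot L))

    injective : ∀ π π′ → LinExtSAW s t π → LinExtSAW s t π′ → Φ s t π ≡ Φ s t π′ → π ≡ π′
    injective π π′ L L′ Φ≡ = shape-injective (linExt⇒interleaving L) (linExt⇒interleaving L′)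
      (reverse-injective (trans (sym (Φ-shape (linExt⇒interleaving L)))
                                (trans Φ≡ (Φ-shape (linExt⇒interleaving L′)))))

    onto : ∀ w → FussCatalan s t w → Σ (List ℕ) λ π → LinExtSAW s t π × (Φ s t π ≡ w)
    onto w fc with π , sp , shape≡ , ballot ← fussCatalan⇒ballot-shape fc =
      π , interleaving⇒linExt sp ballot , (begin
        Φ s t π              ≡⟨ Φ-shape sp ⟩
        reverse (shape sp)   ≡⟨ cong reverse shape≡ ⟩
        reverse (reverse w)  ≡⟨ reverse-involutive w ⟩
        w                    ∎)
      where open ≡-Reasoning
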